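{- Let $G$ be a simple finite connected graph on at least $3$ vertices which is $(\Delta(G)+k)$-total-critical for some integer $k$ with $2<k\leq\Delta(G)$. Then the minimum degree of $G$ is at least $k$.
   Context: $\Delta(G)$ is the maximum degree. A total coloring of $G$ assigns colors to $V(G)\cup E(G)$ so that adjacent vertices, adjacent edges, and an edge and either of its endpoints always receive distinct colors; $\chi''(G)$ is the minimum number of colors in a total coloring. $G$ is $t$-total-critical if $\chi''(G)=t$ and $\chi''(G-e)\leq t-1$ for every edge $e$ of $G$. -}

module Defs where

open import Data.Nat using (ℕ; zero; suc; _+_; _⊔_; _≤_)
open import Data.Bool using (Bool; true; false; if_then_else_; T; _∧_; _∨_; not)
open import Data.Fin using (Fin; _≟_)
open import Data.List using (List; map; foldr)
open import Data.Nat.ListAction using (sum)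
open import Data.List using (allFin)
open import Data.Product using (Σ; _×_; _,_)
open import Relation.Binary.PropositionalEquality using (_≡_; _≢_)
open import Relation.Nullary using (¬_)
open import Relation.Nullary.Decidable using (⌊_⌋)

record Graph (n : ℕ) : Set where
  field
    adj   : Fin n → Fin n → Bool
    sym   : ∀ u v → adj u v ≡ adj v u
    irr   : ∀ v → adj v v ≡ false
open Graph public

Adj : ∀ {n} → Graph n → Fin n → Fin n → Set
Adj G u v = T (adj G u v)

deg : ∀ {n} → Graph n → Fin n → ℕ
deg {n} G u = sum (map (λ v → if adj G u v then 1 else 0) (allFin n))

Δ : ∀ {n} → Graph n → ℕ
Δ {n} G = foldr (λ v m → deg G v ⊔ m) 0 (allFin n)

data Reach {n : ℕ} (G : Graph n) : Fin n → Fin n → Set where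
  here : ∀ {u} → Reach G u u
  step : ∀ {u v w} → Adj G u v → Reach G v w → Reach G u w

Connected : ∀ {n} → Graph n → Set
Connected {n} G = ∀ (u v : Fin n) → Reach G u v

record TotalColoring {n : ℕ} (G : Graph n) (c : ℕ) : Set where
  field
    vc : Fin n → Fin c
    ec : Fin n → Fin n → Fin c
    ec-sym    : ∀ u v → Adj G u v → ec u v ≡ ec v u
    vv-proper : ∀ u v → Adj G u v → vc u ≢ vc v
    ve-proper : ∀ u v → Adj G u v → ec u v ≢ vc u
    ee-proper : ∀ u v w → Adj G u v → Adj G u w → v ≢ w → ec u v ≢ ec u w

χ''≡ : ∀ {n} → Graph n → ℕ → Set
χ''≡ G t = TotalColoring G t × ((m : ℕ) → TotalColoring G m → t ≤ m)

deleteEdge : ∀ {n} → (G : Graph n) → Fin n → Fin n → Graph n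
deleteEdge {n} G a b = record
  { adj = λ u v → adj G u v ∧ not (isab u v ∨ isab v u)
  ; sym = symp
  ; irr = irrp }
  where
  open import Data.Bool.Properties using (∨-comm)
  open import Relation.Binary.PropositionalEquality using (cong₂; cong)
  isab : Fin n → Fin n → Bool
  isab u v = ⌊ u ≟ a ⌋ ∧ ⌊ v ≟ b ⌋
  symp : ∀ u v → (adj G u v ∧ not (isab u v ∨ isab v u)) ≡ (adj G v u ∧ not (isab v u ∨ isab u v))
  symp u v = cong₂ _∧_ (sym G u v) (cong not (∨-comm (isab u v) (isab v u)))
  irrp : ∀ v → (adj G v v ∧ not (isab v v ∨ isab v v)) ≡ false
  irrp v rewrite irr G v = Relation.Binary.PropositionalEquality.refl

TotalCritical : ∀ {n} → Graph n → ℕ → Set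
TotalCritical {n} G t =
  χ''≡ G t ×
  (∀ (a b : Fin n) → Adj G a b → Σ ℕ (λ m → (m Data.Nat.+ 1 ≤ t) × TotalColoring (deleteEdge G a b) m))

-- Suppose deg v ≤ k − 1 and let vu be an edge. By criticality G − vu has a total
-- colouring with Δ + k − 1 colours. At most 1 + (deg u − 1) + (deg v − 1) ≤ Δ + k − 2
-- colours are forbidden for the edge vu once the colour of v is disregarded, so vu can
-- be coloured; then at most 2 deg v ≤ 2k − 2 < Δ + k − 1 colours are forbidden at v, so v
-- can be recoloured. The result is a total colouring of G with Δ + k − 1 colours,
-- contradicting χ''(G) = Δ + k.
module Submission where

open import Defs hiding (sym)
open import Data.Nat using (ℕ; zero; suc; _+_; _≤_; _<_; _⊔_; z≤n; s≤s)
open import Data.Nat.Properties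
  using (module ≤-Reasoning; ≤-trans; ≤-reflexive; ≤-pred; <⇒≤; <-≤-trans; <-irrefl;
         m≤m⊔n; m≤n⊔m; ≰⇒>; _≤?_; +-comm; +-suc; +-mono-≤; +-mono-<-≤)
open import Data.Fin using (Fin; _≟_; inject≤) renaming (zero to fzero; suc to fsuc)
open import Data.Fin.Properties using (all?; ¬∀⟶∃¬; pigeonhole; inject≤-injective; <⇒≢)
open import Data.Bool using (Bool; true; false; if_then_else_; T)
open import Data.List using (List; []; _∷_; map; foldr; length; _++_; allFin; lookup; filter; filterᵇ)
open import Data.List.Properties using (length-map; length-++; filter-notAll)
open import Data.List.Membership.Propositional using (_∈_; _∉_)
import Data.List.Membership.DecPropositional as DecMembership
open import Data.List.Membership.Propositional.Properties
  using (∈-map⁺; ∈-++⁺ˡ; ∈-++⁺ʳ; ∈-allFin; ∈-filter⁺)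
open import Data.List.Relation.Unary.Any as Any using (here; there; index)
open import Data.List.Relation.Unary.Any.Properties using (lookup-index)
open import Data.Nat.ListAction using (sum)
open import Data.Product using (∃; _×_; _,_; proj₁; proj₂)
open import Data.Empty using (⊥; ⊥-elim)
open import Function using (_∘_)
open import Relation.Nullary using (¬_; Dec; yes; no)
open import Relation.Nullary.Decidable using (¬?; T?; _×-dec_)
open import Relation.Binary.PropositionalEquality
  using (_≡_; _≢_; refl; sym; trans; cong; cong₂; subst; subst₂; module ≡-Reasoning)

length-filterᵇ : ∀ {A : Set} (p : A → Bool) (xs : List A) →
  length (filterᵇ p xs) ≡ sum (map (λ x → if p x then 1 else 0) xs)
length-filterᵇ p [] = refl
length-filterᵇ p (x ∷ xs) with p x
... | true  = cong suc (length-filterᵇ p xs)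
... | false = length-filterᵇ p xs

∉∧∈⇒≢ : ∀ {A : Set} {x y : A} {xs} → x ∉ xs → y ∈ xs → x ≢ y
∉∧∈⇒≢ x∉ y∈ refl = x∉ y∈

module _ {c : ℕ} where
  open DecMembership (_≟_ {c}) using (_∈?_)

  fresh : (xs : List (Fin c)) → length xs < c → ∃ (_∉ xs)
  fresh xs |xs|<c with all? (_∈? xs)
  ... | no ¬all = ¬∀⟶∃¬ c (_∈ xs) (_∈? xs) ¬all
  ... | yes all with pigeonhole |xs|<c (λ x → index (all x))
  ...   | i , j , i<j , same = ⊥-elim (<⇒≢ i<j (begin
    i                          ≡⟨ lookup-index (all i) ⟩
    lookup xs (index (all i))  ≡⟨ cong (lookup xs) same ⟩
    lookup xs (index (all j))  ≡⟨ sym (lookup-index (all j)) ⟩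
    j                          ∎))
    where open ≡-Reasoning

module _ {n : ℕ} (G : Graph n) where

  Adj-sym : ∀ {x y} → Adj G x y → Adj G y x
  Adj-sym {x} {y} = subst T (Graph.sym G x y)

  Adj-irrefl : ∀ {x} → ¬ Adj G x x
  Adj-irrefl {x} = subst T (irr G x)

  Adj-deleteEdge : ∀ {a b x y} → Adj G x y → ¬ (x ≡ a × y ≡ b) → ¬ (y ≡ a × x ≡ b) →
    Adj (deleteEdge G a b) x y
  Adj-deleteEdge {a} {b} {x} {y} xy ¬ab ¬ba with adj G x y | x ≟ a | y ≟ b | y ≟ a | x ≟ b
  ... | true | yes x≡a | yes y≡b | _       | _       = ⊥-elim (¬ab (x≡a , y≡b))
  ... | true | _       | _       | yes y≡a | yes x≡b = ⊥-elim (¬ba (y≡a , x≡b))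
  ... | true | no _    | _       | no _    | _       = _
  ... | true | no _    | _       | yes _   | no _    = _
  ... | true | yes _   | no _    | no _    | _       = _
  ... | true | yes _   | no _    | yes _   | no _    = _

  neighbours : Fin n → List (Fin n)
  neighbours x = filterᵇ (adj G x) (allFin n)

  neighboursExcept : Fin n → Fin n → List (Fin n)
  neighboursExcept x z = filter (¬? ∘ (_≟ z)) (neighbours x)

  length-neighbours : ∀ x → length (neighbours x) ≡ deg G x
  length-neighbours x = length-filterᵇ (adj G x) (allFin n)

  ∈-neighbours : ∀ {x y} → Adj G x y → y ∈ neighbours x
  ∈-neighbours {x} {y} xy = ∈-filter⁺ (λ z → T? (adj G x z)) (∈-allFin y) xy

  ∈-neighboursExcept : ∀ {x y z} → Adj G x y → y ≢ z → y ∈ neighboursExcept x z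
  ∈-neighboursExcept xy y≢z = ∈-filter⁺ (¬? ∘ (_≟ _)) (∈-neighbours xy) y≢z

  length-neighboursExcept : ∀ {x z} → Adj G x z → length (neighboursExcept x z) < deg G x
  length-neighboursExcept {x} {z} xz = <-≤-trans
    (filter-notAll (¬? ∘ (_≟ z)) (neighbours x) (Any.map (λ { refl z≢z → z≢z refl }) (∈-neighbours xz)))
    (≤-reflexive (length-neighbours x))

  deg≤Δ : ∀ x → deg G x ≤ Δ G
  deg≤Δ x = ≤-foldr-⊔ (∈-allFin x)
    where
    ≤-foldr-⊔ : ∀ {xs} → x ∈ xs → deg G x ≤ foldr (λ y m → deg G y ⊔ m) 0 xs
    ≤-foldr-⊔ (here refl) = m≤m⊔n _ _
    ≤-foldr-⊔ {y ∷ _} (there x∈) = ≤-trans (≤-foldr-⊔ x∈) (m≤n⊔m (deg G y) _)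

  Reach⇒∃Adj : ∀ {x y} → Reach G x y → x ≢ y → ∃ (Adj G x)
  Reach⇒∃Adj here        x≢x = ⊥-elim (x≢x refl)
  Reach⇒∃Adj (step xz _) _   = _ , xz

  ∃-neighbour : 2 ≤ n → Connected G → ∀ x → ∃ (Adj G x)
  ∃-neighbour (s≤s (s≤s _)) conn x with x ≟ fzero
  ... | yes refl = Reach⇒∃Adj (conn x (fsuc fzero)) λ ()
  ... | no x≢0   = Reach⇒∃Adj (conn x fzero) x≢0

inject≤-TotalColoring : ∀ {n} {G : Graph n} {m c} → m ≤ c → TotalColoring G m → TotalColoring G c
inject≤-TotalColoring m≤c C = record
  { vc        = λ x → inject≤ (vc x) m≤c
  ; ec        = λ x y → inject≤ (ec x y) m≤c
  ; ec-sym    = λ x y xy → cong (λ i → inject≤ i m≤c) (ec-sym x y xy)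
  ; vv-proper = λ x y xy → vv-proper x y xy ∘ injective
  ; ve-proper = λ x y xy → ve-proper x y xy ∘ injective
  ; ee-proper = λ x y z xy xz y≢z → ee-proper x y z xy xz y≢z ∘ injective
  }
  where
  open TotalColoring C
  injective : ∀ {i j} → inject≤ i m≤c ≡ inject≤ j m≤c → i ≡ j
  injective = inject≤-injective m≤c m≤c _ _

module Extension {n} {G : Graph n} {v u : Fin n} (vu : Adj G v u)
                 {c} (C : TotalColoring (deleteEdge G v u) c) where
  open TotalColoring C

  data IsEdge : Fin n → Fin n → Set where
    isVU : IsEdge v u
    isUV : IsEdge u v

  isEdge? : ∀ x y → Dec (IsEdge x y)
  isEdge? x y with (x ≟ v) ×-dec (y ≟ u) | (x ≟ u) ×-dec (y ≟ v)
  ... | yes (refl , refl) | _                 = yes isVU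
  ... | _                 | yes (refl , refl) = yes isUV
  ... | no ¬vu            | no ¬uv            = no λ { isVU → ¬vu (refl , refl) ; isUV → ¬uv (refl , refl) }

  IsEdge-sym : ∀ {x y} → IsEdge x y → IsEdge y x
  IsEdge-sym isVU = isUV
  IsEdge-sym isUV = isVU

  Adj-otherEdge : ∀ {x y} → Adj G x y → ¬ IsEdge x y → Adj (deleteEdge G v u) x y
  Adj-otherEdge xy ¬e = Adj-deleteEdge G xy (λ { (refl , refl) → ¬e isVU }) (λ { (refl , refl) → ¬e isUV })

  u≢v : u ≢ v
  u≢v refl = Adj-irrefl G vu

  -- vc v is not forbidden: v is recoloured afterwards.
  forbiddenForEdge : List (Fin c)
  forbiddenForEdge = vc u ∷ map (ec u) (neighboursExcept G u v) ++ map (ec v) (neighboursExcept G v u)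

  module RecolourEdge (β : Fin c) (β∉ : β ∉ forbiddenForEdge) where
    -- Opaque, so that with-abstraction in the proofs below leaves ec′ and vc′ folded.
    opaque
      ec′ : Fin n → Fin n → Fin c
      ec′ x y with isEdge? x y
      ... | yes _ = β
      ... | no _  = ec x y

      ec′-edge : ∀ {x y} → IsEdge x y → ec′ x y ≡ β
      ec′-edge {x} {y} e with isEdge? x y
      ... | yes _ = refl
      ... | no ¬e = ⊥-elim (¬e e)

      ec′-otherEdge : ∀ {x y} → ¬ IsEdge x y → ec′ x y ≡ ec x y
      ec′-otherEdge {x} {y} ¬e with isEdge? x y
      ... | yes e = ⊥-elim (¬e e)
      ... | no _  = refl

    β≢vc-u : β ≢ vc u
    β≢vc-u = ∉∧∈⇒≢ β∉ (here refl)

    β≢ec-otherEdge : ∀ {x y z} → IsEdge x y → Adj G x z → y ≢ z → β ≢ ec x z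
    β≢ec-otherEdge isVU vz u≢z = ∉∧∈⇒≢ β∉ (there (∈-++⁺ʳ _ (∈-map⁺ (ec v) (∈-neighboursExcept G vz (u≢z ∘ sym)))))
    β≢ec-otherEdge isUV uz v≢z = ∉∧∈⇒≢ β∉ (there (∈-++⁺ˡ (∈-map⁺ (ec u) (∈-neighboursExcept G uz (v≢z ∘ sym)))))

    forbiddenForVertex : List (Fin c)
    forbiddenForVertex = map vc (neighbours G v) ++ map (ec′ v) (neighbours G v)

    module RecolourVertex (α : Fin c) (α∉ : α ∉ forbiddenForVertex) where
      opaque
        vc′ : Fin n → Fin c
        vc′ x with x ≟ v
        ... | yes _ = α
        ... | no _  = vc x

        vc′-v : ∀ {x} → x ≡ v → vc′ x ≡ α
        vc′-v {x} x≡v with x ≟ v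
        ... | yes _   = refl
        ... | no x≢v = ⊥-elim (x≢v x≡v)

        vc′-other : ∀ {x} → x ≢ v → vc′ x ≡ vc x
        vc′-other {x} x≢v with x ≟ v
        ... | yes x≡v = ⊥-elim (x≢v x≡v)
        ... | no _    = refl

      α≢vc : ∀ {y} → Adj G v y → α ≢ vc y
      α≢vc vy = ∉∧∈⇒≢ α∉ (∈-++⁺ˡ (∈-map⁺ vc (∈-neighbours G vy)))

      α≢ec′ : ∀ {y} → Adj G v y → α ≢ ec′ v y
      α≢ec′ vy = ∉∧∈⇒≢ α∉ (∈-++⁺ʳ _ (∈-map⁺ (ec′ v) (∈-neighbours G vy)))

      α≢β : α ≢ β
      α≢β = subst (α ≢_) (ec′-edge isVU) (α≢ec′ vu)

      ec′-sym : ∀ x y → Adj G x y → ec′ x y ≡ ec′ y x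
      ec′-sym x y xy with isEdge? x y
      ... | yes e = trans (ec′-edge e) (sym (ec′-edge (IsEdge-sym e)))
      ... | no ¬e = begin
        ec′ x y  ≡⟨ ec′-otherEdge ¬e ⟩
        ec x y   ≡⟨ ec-sym x y (Adj-otherEdge xy ¬e) ⟩
        ec y x   ≡⟨ sym (ec′-otherEdge (¬e ∘ IsEdge-sym)) ⟩
        ec′ y x  ∎
        where open ≡-Reasoning

      vv-proper′ : ∀ x y → Adj G x y → vc′ x ≢ vc′ y
      vv-proper′ x y xy with x ≟ v | y ≟ v
      ... | yes refl | yes refl = λ _ → Adj-irrefl G xy
      ... | yes refl | no y≢v   = subst₂ _≢_ (sym (vc′-v refl)) (sym (vc′-other y≢v)) (α≢vc xy)
      ... | no x≢v   | yes refl = subst₂ _≢_ (sym (vc′-other x≢v)) (sym (vc′-v refl)) (α≢vc (Adj-sym G xy) ∘ sym)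
      ... | no x≢v   | no y≢v   = subst₂ _≢_ (sym (vc′-other x≢v)) (sym (vc′-other y≢v))
                                    (vv-proper x y (Adj-otherEdge xy ¬e))
        where
        ¬e : ¬ IsEdge x y
        ¬e isVU = x≢v refl
        ¬e isUV = y≢v refl

      ve-proper′ : ∀ x y → Adj G x y → ec′ x y ≢ vc′ x
      ve-proper′ x y xy with isEdge? x y | x ≟ v
      ... | yes isVU | _        = subst₂ _≢_ (sym (ec′-edge isVU)) (sym (vc′-v refl)) (α≢β ∘ sym)
      ... | yes isUV | _        = subst₂ _≢_ (sym (ec′-edge isUV)) (sym (vc′-other u≢v)) β≢vc-u
      ... | no _     | yes refl = subst (ec′ v y ≢_) (sym (vc′-v refl)) (α≢ec′ xy ∘ sym)
      ... | no ¬e    | no x≢v   = subst₂ _≢_ (sym (ec′-otherEdge ¬e)) (sym (vc′-other x≢v))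
                                    (ve-proper x y (Adj-otherEdge xy ¬e))

      ee-proper′ : ∀ x y z → Adj G x y → Adj G x z → y ≢ z → ec′ x y ≢ ec′ x z
      ee-proper′ x y z xy xz y≢z with isEdge? x y | isEdge? x z
      ... | yes isVU | yes isVU = λ _ → y≢z refl
      ... | yes isUV | yes isUV = λ _ → y≢z refl
      ... | yes isVU | yes isUV = λ _ → u≢v refl
      ... | yes isUV | yes isVU = λ _ → u≢v refl
      ... | yes e    | no ¬e    = subst₂ _≢_ (sym (ec′-edge e)) (sym (ec′-otherEdge ¬e)) (β≢ec-otherEdge e xz y≢z)
      ... | no ¬e    | yes e    = subst₂ _≢_ (sym (ec′-otherEdge ¬e)) (sym (ec′-edge e)) (β≢ec-otherEdge e xy (y≢z ∘ sym) ∘ sym)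
      ... | no ¬e    | no ¬e′   = subst₂ _≢_ (sym (ec′-otherEdge ¬e)) (sym (ec′-otherEdge ¬e′))
                                    (ee-proper x y z (Adj-otherEdge xy ¬e) (Adj-otherEdge xz ¬e′) y≢z)

      coloring : TotalColoring G c
      coloring = record
        { vc = vc′ ; ec = ec′ ; ec-sym = ec′-sym
        ; vv-proper = vv-proper′ ; ve-proper = ve-proper′ ; ee-proper = ee-proper′ }

extendColoring : ∀ {n} {G : Graph n} {v u} → Adj G v u → ∀ {c} → TotalColoring (deleteEdge G v u) c →
  deg G u + deg G v ≤ c → deg G v + deg G v < c → TotalColoring G c
extendColoring {n} {G} {v} {u} vu {c} C degSum degTwice = RecolourVertex.coloring α α∉
  where
  open Extension vu C
  open TotalColoring C using (vc; ec)
  open ≤-Reasoning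

  Nv Nu∖v Nv∖u : List (Fin n)
  Nv = neighbours G v
  Nu∖v = neighboursExcept G u v
  Nv∖u = neighboursExcept G v u

  |forbiddenForEdge|<c : length forbiddenForEdge < c
  |forbiddenForEdge|<c = begin-strict
    length forbiddenForEdge  ≡⟨ cong suc (length-++ (map (ec u) Nu∖v)) ⟩
    suc (length (map (ec u) Nu∖v) + length (map (ec v) Nv∖u))
      ≡⟨ cong suc (cong₂ _+_ (length-map (ec u) Nu∖v) (length-map (ec v) Nv∖u)) ⟩
    suc (length Nu∖v + length Nv∖u)  <⟨ ≤-reflexive (sym (+-suc (suc (length Nu∖v)) (length Nv∖u))) ⟩
    suc (length Nu∖v) + suc (length Nv∖u)
      ≤⟨ +-mono-≤ (length-neighboursExcept G (Adj-sym G vu)) (length-neighboursExcept G vu) ⟩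
    deg G u + deg G v        ≤⟨ degSum ⟩
    c                        ∎

  β : Fin c
  β = proj₁ (fresh forbiddenForEdge |forbiddenForEdge|<c)
  open RecolourEdge β (proj₂ (fresh forbiddenForEdge |forbiddenForEdge|<c))

  |forbiddenForVertex|<c : length forbiddenForVertex < c
  |forbiddenForVertex|<c = begin-strict
    length forbiddenForVertex  ≡⟨ length-++ (map vc Nv) ⟩
    length (map vc Nv) + length (map (ec′ v) Nv)  ≡⟨ cong₂ _+_ (length-map vc Nv) (length-map (ec′ v) Nv) ⟩
    length Nv + length Nv      ≡⟨ cong₂ _+_ (length-neighbours G v) (length-neighbours G v) ⟩
    deg G v + deg G v          <⟨ degTwice ⟩
    c                          ∎

  α : Fin c
  α = proj₁ (fresh forbiddenForVertex |forbiddenForVertex|<c)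
  α∉ : α ∉ forbiddenForVertex
  α∉ = proj₂ (fresh forbiddenForVertex |forbiddenForVertex|<c)

TotalCritical⇒edgeDegrees : ∀ {n} {G : Graph n} {c v u} → TotalCritical G (suc c) → Adj G v u →
  deg G u + deg G v ≤ c → deg G v + deg G v < c → ⊥
TotalCritical⇒edgeDegrees {G = G} {c} {v} {u} ((_ , minimal) , critical) vu degSum degTwice =
  <-irrefl refl (minimal c (extendColoring vu (inject≤-TotalColoring m≤c C) degSum degTwice))
  where
  m : ℕ
  m = proj₁ (critical v u vu)
  C : TotalColoring (deleteEdge G v u) m
  C = proj₂ (proj₂ (critical v u vu))
  m≤c : m ≤ c
  m≤c = ≤-pred (≤-trans (≤-reflexive (+-comm 1 m)) (proj₁ (proj₂ (critical v u vu))))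

lemma2 : (n : ℕ) → (G : Graph n) → 3 ≤ n → Connected G →
    (k : ℕ) → 2 < k → k ≤ Δ G → TotalCritical G (Δ G + k) →
    (v : Fin n) → k ≤ deg G v
lemma2 n G _   _    zero    _ _   _        v = z≤n
lemma2 n G 3≤n conn (suc k) _ k<Δ critical v with suc k ≤? deg G v
... | yes k<deg = k<deg
... | no  k≮deg = ⊥-elim (TotalCritical⇒edgeDegrees critical′ vu degSum degTwice)
  where
  deg≤k : deg G v ≤ k
  deg≤k = ≤-pred (≰⇒> k≮deg)
  u : Fin n
  u = proj₁ (∃-neighbour G (<⇒≤ 3≤n) conn v)
  vu : Adj G v u
  vu = proj₂ (∃-neighbour G (<⇒≤ 3≤n) conn v)
  critical′ : TotalCritical G (suc (Δ G + k))
  critical′ = subst (TotalCritical G) (+-suc (Δ G) k) critical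
  degSum : deg G u + deg G v ≤ Δ G + k
  degSum = +-mono-≤ (deg≤Δ G u) deg≤k
  degTwice : deg G v + deg G v < Δ G + k
  degTwice = +-mono-<-≤ (<-≤-trans (s≤s deg≤k) k<Δ) deg≤k
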